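{- For any binary Boolean VCSP instance $\mathcal{C}'$, there exists a simple trim binary Boolean VCSP instance $\mathcal{C}$ that is sign-equivalent to $\mathcal{C}'$ and satisfies $\mathrm{span}(\mathcal{C})\le 4\,\mathrm{span}(\mathcal{C}')$.
   Context: Variables are indexed by $[n]$, each with domain $\{0,1\}$; points are $x\in\{0,1\}^n$; $x[i\mapsto b]$ is $x$ with coordinate $i$ set to $b$, $\bar b=1-b$. A (valued) constraint with scope $S\subseteq[n]$ is a function $C_S:\{0,1\}^S\to\mathbb{Z}$. A binary Boolean VCSP instance is a finite set of constraints with scopes of size at most $2$, at most one per scope; it implements $f(x)=\sum_{C_S\in\mathcal{C}}C_S(x[S])$. Its fitness graph $G_\mathcal{C}$ has vertex set $\{0,1\}^n$ and a directed edge $(x,y)$ iff $x,y$ differ in exactly one coordinate and $f(y)>f(x)$; two instances are sign-equivalent if they have the same fitness graph. The constraint graph has edge set $E(\mathcal{C})$ of those $\{i,j\}$ for which $\mathcal{C}$ has a binary constraint with scope $\{i,j\}$ that is not identically zero. The span of an instance is $\mathrm{span}(\mathcal{C})=\sum_{C_S\in\mathcal{C}}(\max_z C_S(z)-\min_z C_S(z))$. An instance is simple if every unary constraint satisfies $C_i(0)=0,C_i(1)=c_i$ and every binary constraint satisfies $C_{ij}(0,0)=C_{ij}(0,1)=C_{ij}(1,0)=0$, $C_{ij}(1,1)=c_{ij}$ (a constant constraint is allowed). In $G_\mathcal{C}$, $i$ sign-depends on $j$ if there is $x$ with $(x,x[i\mapsto\bar x_i])\in E(G_\mathcal{C})$ but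 $(x[j\mapsto \bar x_j],x[i\mapsto\bar x_i,j\mapsto\bar x_j])\notin E(G_\mathcal{C})$; $i,j$ sign-interact if either sign-depends on the other. A simple instance $\mathcal{C}$ is trim if for every $\{i,j\}\in E(\mathcal{C})$, $i$ and $j$ sign-interact in $G_\mathcal{C}$. -}

module Defs where

open import Data.Bool using (Bool; true; false; not)
open import Data.Nat using (ℕ)
open import Data.Fin using (Fin; _<_; _<?_)
open import Data.Fin.Properties using ()
open import Data.List using (List; []; _∷_; foldr; map; concatMap)
open import Data.List.Base using (allFin)
open import Data.Integer using (ℤ; 0ℤ; _+_; _-_; _⊔_; _⊓_) renaming (_<_ to _<ℤ_)
open import Data.Vec using (Vec; lookup; _[_]≔_)
open import Data.Product using (Σ; ∃; ∃-syntax; _×_; _,_)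
open import Data.Sum using (_⊎_)
open import Relation.Binary.PropositionalEquality using (_≡_; _≢_)
open import Relation.Nullary using (¬_; yes; no)

-- A binary Boolean VCSP instance on n variables (variables = Fin n,
-- domain {0,1} = Bool with false = 0, true = 1).
-- Constraints are given per scope; an absent constraint is represented by the
-- identically-zero constraint (this changes neither f, the span, E(C), nor
-- simplicity).  Scopes: ∅ (constant), {i}, and {i,j} with i < j; for the latter
-- only the entries `binary i j` with i < j are used, with arguments (x_i, x_j).
record Instance (n : ℕ) : Set where
  field
    nullary : ℤ
    unary   : Fin n → Bool → ℤ
    binary  : Fin n → Fin n → Bool → Bool → ℤ
open Instance public

Point : ℕ → Set
Point n = Vec Bool n

flip : {n : ℕ} → Point n → Fin n → Point n
flip x i = x [ i ]≔ not (lookup x i)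

sumℤ : List ℤ → ℤ
sumℤ = foldr _+_ 0ℤ

pairs : (n : ℕ) → List (Fin n × Fin n)
pairs n = concatMap (λ i → concatMap (λ j → sel i j) (allFin n)) (allFin n)
  where
  sel : Fin n → Fin n → List (Fin n × Fin n)
  sel i j with i <? j
  ... | yes _ = (i , j) ∷ []
  ... | no  _ = []

eval : {n : ℕ} → Instance n → Point n → ℤ
eval {n} C x =
  nullary C
  + sumℤ (map (λ i → unary C i (lookup x i)) (allFin n))
  + sumℤ (map (λ { (i , j) → binary C i j (lookup x i) (lookup x j) }) (pairs n))

Edge : {n : ℕ} → Instance n → Point n → Point n → Set
Edge C x y = (∃[ i ] y ≡ flip x i) × (eval C x <ℤ eval C y)

SignEquivalent : {n : ℕ} → Instance n → Instance n → Set
SignEquivalent C D = ∀ x y → (Edge C x y → Edge D x y) × (Edge D x y → Edge C x y)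

max2 min2 : (Bool → ℤ) → ℤ
max2 g = g false ⊔ g true
min2 g = g false ⊓ g true

max4 min4 : (Bool → Bool → ℤ) → ℤ
max4 g = max2 (g false) ⊔ max2 (g true)
min4 g = min2 (g false) ⊓ min2 (g true)

span : {n : ℕ} → Instance n → ℤ
span {n} C =
  (nullary C - nullary C)
  + sumℤ (map (λ i → max2 (unary C i) - min2 (unary C i)) (allFin n))
  + sumℤ (map (λ { (i , j) → max4 (binary C i j) - min4 (binary C i j) }) (pairs n))

InE : {n : ℕ} → Instance n → Fin n → Fin n → Set
InE C i j = (i < j) × (∃[ a ] ∃[ b ] binary C i j a b ≢ 0ℤ)

Simple : {n : ℕ} → Instance n → Set
Simple {n} C =
  (∀ i → unary C i false ≡ 0ℤ)
  × (∀ (i j : Fin n) → i < j →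
       (binary C i j false false ≡ 0ℤ)
       × (binary C i j false true ≡ 0ℤ)
       × (binary C i j true false ≡ 0ℤ))

SignDepends : {n : ℕ} → Instance n → Fin n → Fin n → Set
SignDepends C i j =
  ∃[ x ] Edge C x (flip x i) × ¬ Edge C (flip x j) (flip (flip x j) i)

SignInteract : {n : ℕ} → Instance n → Fin n → Fin n → Set
SignInteract C i j = SignDepends C i j ⊎ SignDepends C j i

Trim : {n : ℕ} → Instance n → Set
Trim {n} C = Simple C × (∀ (i j : Fin n) → InE C i j → SignInteract C i j)

-- Expanding every binary constraint as h(a,b) = h(0,0) + a·α + b·β + ab·γ and moving h(0,0), α, β
-- into the nullary and unary parts gives a simple instance with the same f; each coefficient is a
-- difference of two values of one constraint, so the span grows by at most a factor 4.
-- Then every binary constraint γ x_i x_j whose variables do not sign-interact is deleted, one at a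
-- time.  A deletion changes f only where x_i = x_j = 1, so flips of other variables are unaffected,
-- and a flip of i at a point with x_j = 1 has the same sign as the flip at x^j, both before (i does
-- not sign-depend on j) and after the deletion (no i–j interaction is left).  Sign interaction is
-- invariant under sign equivalence, so the decisions may all be taken on the simple instance, and
-- deleting constraints only lowers the span.
module Submission where

open import Defs
open import Data.Nat using (ℕ; zero; suc)
open import Data.Bool using (Bool; true; false; not; _∧_)
open import Data.Bool.Properties using (not-involutive; ∧-zeroʳ) renaming (_≟_ to _≟ᵇ_)
open import Data.Fin using (Fin; zero; suc)
open import Data.Fin.Properties using (_≟_; any?; <⇒≢)
open import Data.Integer using (ℤ; 0ℤ; +_; _+_; _-_; -_; _*_; _⊔_; _⊓_; _≤_) renaming (_<_ to _<ℤ_)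
open import Data.Integer.Properties hiding (_≟_; <⇒≢)
open import Data.Integer.Tactic.RingSolver using (solve-∀)
open import Algebra.Properties.CommutativeSemigroup +-commutativeSemigroup using (interchange)
open import Data.List using (List; []; _∷_; map; tabulate; cartesianProduct)
open import Data.List.Base using (allFin)
open import Data.List.Properties using (map-tabulate)
open import Data.List.Membership.Propositional using (_∈_)
open import Data.List.Membership.Propositional.Properties using (∈-allFin; ∈-cartesianProduct⁺)
open import Data.List.Relation.Unary.Any using (here; there)
open import Data.Vec using ([]; _∷_; lookup; _[_]≔_)
open import Data.Vec.Properties
  using (lookup∘update; lookup∘update′; []≔-idempotent; []≔-commutes; []≔-lookup; ≡-dec)
open import Data.Product using (∃-syntax; _×_; _,_; proj₁; proj₂)
open import Data.Sum using (_⊎_; inj₁; inj₂) renaming (swap to ⊎-swap)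
open import Data.Empty using (⊥-elim)
open import Function using (_∘_; id)
open import Function.Bundles using (_⇔_; mk⇔; Equivalence)
open import Relation.Binary.PropositionalEquality
open import Relation.Nullary using (¬_; Dec; yes; no)
open import Relation.Nullary.Decidable using (_×-dec_; _⊎-dec_; ¬?)

open Equivalence using (to; from)

∑ : {A : Set} → List A → (A → ℤ) → ℤ
∑ l f = sumℤ (map f l)

module _ {A : Set} where

  ∑-distrib-+ : (l : List A) (f g : A → ℤ) → ∑ l (λ e → f e + g e) ≡ ∑ l f + ∑ l g
  ∑-distrib-+ []      f g = refl
  ∑-distrib-+ (a ∷ l) f g =
    trans (cong (λ s → f a + g a + s) (∑-distrib-+ l f g)) (interchange (f a) (g a) (∑ l f) (∑ l g))

  ∑-cong : (l : List A) {f g : A → ℤ} → (∀ e → f e ≡ g e) → ∑ l f ≡ ∑ l g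
  ∑-cong []      h = refl
  ∑-cong (a ∷ l) h = cong₂ _+_ (h a) (∑-cong l h)

  ∑-mono-≤ : (l : List A) {f g : A → ℤ} → (∀ e → f e ≤ g e) → ∑ l f ≤ ∑ l g
  ∑-mono-≤ []      h = ≤-refl
  ∑-mono-≤ (a ∷ l) h = +-mono-≤ (h a) (∑-mono-≤ l h)

  ∑-zero : (l : List A) → ∑ l (λ _ → 0ℤ) ≡ 0ℤ
  ∑-zero []      = refl
  ∑-zero (a ∷ l) = trans (+-identityˡ _) (∑-zero l)

  ∑-nonneg : (l : List A) {f : A → ℤ} → (∀ e → 0ℤ ≤ f e) → 0ℤ ≤ ∑ l f
  ∑-nonneg l {f} h = subst (_≤ ∑ l f) (∑-zero l) (∑-mono-≤ l h)

∑-comm : {A B : Set} (l : List A) (m : List B) (F : A → B → ℤ) →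
         ∑ l (λ a → ∑ m (F a)) ≡ ∑ m (λ b → ∑ l (λ a → F a b))
∑-comm []      m F = sym (∑-zero m)
∑-comm (a ∷ l) m F =
  trans (cong (λ s → ∑ m (F a) + s) (∑-comm l m F)) (sym (∑-distrib-+ m (F a) (λ b → ∑ l (λ a → F a b))))

infixr 7 _·_
_·_ : Bool → ℤ → ℤ
false · v = 0ℤ
true  · v = v

·-zero : ∀ b → b · 0ℤ ≡ 0ℤ
·-zero false = refl
·-zero true  = refl

·-distrib-+ : ∀ b u v → b · (u + v) ≡ b · u + b · v
·-distrib-+ false u v = refl
·-distrib-+ true  u v = refl

·-∑ : {A : Set} (b : Bool) (l : List A) (f : A → ℤ) → b · ∑ l f ≡ ∑ l (λ e → b · f e)
·-∑ false l f = sym (∑-zero l)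
·-∑ true  l f = refl

·-vanishes : ∀ {a b} v → a ≡ false ⊎ b ≡ false → (a ∧ b) · v ≡ 0ℤ
·-vanishes     v (inj₁ refl) = refl
·-vanishes {a} v (inj₂ refl) rewrite ∧-zeroʳ a = refl

δ : ∀ {n} → Fin n → Fin n → ℤ → ℤ
δ zero    zero    v = v
δ zero    (suc _) v = 0ℤ
δ (suc _) zero    v = 0ℤ
δ (suc q) (suc p) v = δ q p v

·-δ : ∀ {n} b (q p : Fin n) v → b · δ q p v ≡ δ q p (b · v)
·-δ b zero    zero    v = refl
·-δ b zero    (suc p) v = ·-zero b
·-δ b (suc q) zero    v = ·-zero b
·-δ b (suc q) (suc p) v = ·-δ b q p v

sum-tabulate-zero : ∀ n → sumℤ (tabulate {n = n} (λ _ → 0ℤ)) ≡ 0ℤ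
sum-tabulate-zero zero    = refl
sum-tabulate-zero (suc n) = trans (+-identityˡ _) (sum-tabulate-zero n)

sum-tabulate-δ : ∀ {n} (q : Fin n) (h : Fin n → ℤ) → sumℤ (tabulate (λ p → δ q p (h p))) ≡ h q
sum-tabulate-δ {suc n} zero    h = trans (cong (λ s → h zero + s) (sum-tabulate-zero n)) (+-identityʳ _)
sum-tabulate-δ {suc n} (suc q) h = trans (+-identityˡ _) (sum-tabulate-δ q (h ∘ suc))

∑-δ : ∀ {n} (q : Fin n) (h : Fin n → ℤ) → ∑ (allFin n) (λ p → δ q p (h p)) ≡ h q
∑-δ {n} q h = trans (cong sumℤ (map-tabulate {n = n} id (λ p → δ q p (h p)))) (sum-tabulate-δ q h)

i≤i+nonneg : ∀ {a b} → 0ℤ ≤ b → a ≤ a + b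
i≤i+nonneg {a} {b} 0≤b = subst (_≤ a + b) (+-identityʳ a) (+-monoʳ-≤ a 0≤b)

infix 4 ∣_∣≤_
∣_∣≤_ : ℤ → ℤ → Set
∣ c ∣≤ K = (c ≤ K) × (- c ≤ K)

∣∣≤-zero : ∣ 0ℤ ∣≤ 0ℤ
∣∣≤-zero = ≤-refl , ≤-refl

∣∣≤-+ : ∀ {a b K L} → ∣ a ∣≤ K → ∣ b ∣≤ L → ∣ a + b ∣≤ K + L
∣∣≤-+ {a} {b} (a≤K , -a≤K) (b≤L , -b≤L) =
  +-mono-≤ a≤K b≤L , subst (_≤ _) (sym (neg-distrib-+ a b)) (+-mono-≤ -a≤K -b≤L)

∣∣≤-∑ : {A : Set} (l : List A) {f k : A → ℤ} → (∀ e → ∣ f e ∣≤ k e) → ∣ ∑ l f ∣≤ ∑ l k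
∣∣≤-∑ []      h = ∣∣≤-zero
∣∣≤-∑ (a ∷ l) h = ∣∣≤-+ (h a) (∣∣≤-∑ l h)

∣∣≤-δ : ∀ {n} (q p : Fin n) {v K} → ∣ v ∣≤ K → ∣ δ q p v ∣≤ δ q p K
∣∣≤-δ zero    zero    b = b
∣∣≤-δ zero    (suc p) b = ∣∣≤-zero
∣∣≤-δ (suc q) zero    b = ∣∣≤-zero
∣∣≤-δ (suc q) (suc p) b = ∣∣≤-δ q p b

∣-∣≤-width : ∀ {m M a b} → m ≤ a → a ≤ M → m ≤ b → b ≤ M → ∣ a - b ∣≤ M - m
∣-∣≤-width {a = a} {b} m≤a a≤M m≤b b≤M =
  +-mono-≤ a≤M (neg-mono-≤ m≤b) ,
  subst (_≤ _) (sym (neg-minus a b)) (+-mono-≤ b≤M (neg-mono-≤ m≤a))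
  where
  neg-minus : ∀ a b → - (a - b) ≡ b - a
  neg-minus = solve-∀

range₂ : (Bool → ℤ) → ℤ
range₂ u = max2 u - min2 u

range₄ : (Bool → Bool → ℤ) → ℤ
range₄ g = max4 g - min4 g

range₂-indicator : ∀ {c K} → ∣ c ∣≤ K → range₂ (λ b → b · c) ≤ K
range₂-indicator {c} (c≤K , -c≤K) with 0ℤ ≤? c
... | yes 0≤c rewrite i≤j⇒i⊔j≡j 0≤c | i≤j⇒i⊓j≡i 0≤c = subst (_≤ _) (sym (+-identityʳ c)) c≤K
... | no  0≰c =
  subst (_≤ _) (sym (trans (cong₂ _-_ (i≥j⇒i⊔j≡i c≤0) (i≥j⇒i⊓j≡j c≤0)) (+-identityˡ (- c)))) -c≤K
  where c≤0 = <⇒≤ (≰⇒> 0≰c)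

min2≤∧≤max2 : (u : Bool → ℤ) (b : Bool) → (min2 u ≤ u b) × (u b ≤ max2 u)
min2≤∧≤max2 u false = i⊓j≤i _ _ , i≤i⊔j _ _
min2≤∧≤max2 u true  = i⊓j≤j _ _ , i≤j⊔i _ _

min4≤∧≤max4 : (g : Bool → Bool → ℤ) (a b : Bool) → (min4 g ≤ g a b) × (g a b ≤ max4 g)
min4≤∧≤max4 g false b =
  ≤-trans (i⊓j≤i _ _) (proj₁ (min2≤∧≤max2 (g false) b)) ,
  ≤-trans (proj₂ (min2≤∧≤max2 (g false) b)) (i≤i⊔j _ _)
min4≤∧≤max4 g true  b =
  ≤-trans (i⊓j≤j _ _) (proj₁ (min2≤∧≤max2 (g true) b)) ,
  ≤-trans (proj₂ (min2≤∧≤max2 (g true) b)) (i≤j⊔i _ _)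

∣-∣≤range₂ : (u : Bool → ℤ) (a b : Bool) → ∣ u a - u b ∣≤ range₂ u
∣-∣≤range₂ u a b = ∣-∣≤-width (proj₁ ra) (proj₂ ra) (proj₁ rb) (proj₂ rb)
  where ra = min2≤∧≤max2 u a; rb = min2≤∧≤max2 u b

∣-∣≤range₄ : (g : Bool → Bool → ℤ) (a b c d : Bool) → ∣ g a b - g c d ∣≤ range₄ g
∣-∣≤range₄ g a b c d = ∣-∣≤-width (proj₁ rab) (proj₂ rab) (proj₁ rcd) (proj₂ rcd)
  where rab = min4≤∧≤max4 g a b; rcd = min4≤∧≤max4 g c d

range₂-nonneg : (u : Bool → ℤ) → 0ℤ ≤ range₂ u
range₂-nonneg u = i≤j⇒0≤j-i (i⊓j≤i⊔j (u false) (u true))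

range₄-nonneg : (g : Bool → Bool → ℤ) → 0ℤ ≤ range₄ g
range₄-nonneg g = i≤j⇒0≤j-i (≤-trans (proj₁ r) (proj₂ r))
  where r = min4≤∧≤max4 g false false

range₂-cong : {u v : Bool → ℤ} → (∀ b → u b ≡ v b) → range₂ u ≡ range₂ v
range₂-cong {u} {v} e rewrite e false | e true = refl

range₄-cong : {g h : Bool → Bool → ℤ} → (∀ a b → g a b ≡ h a b) → range₄ g ≡ range₄ h
range₄-cong {g} {h} e rewrite e false false | e false true | e true false | e true true = refl

range₄-indicator : ∀ {c K} → ∣ c ∣≤ K → range₄ (λ a b → (a ∧ b) · c) ≤ K
range₄-indicator {c} b =
  subst (_≤ _) (sym (cong₂ _-_ (sym (⊔-assoc 0ℤ 0ℤ c)) (sym (⊓-assoc 0ℤ 0ℤ c)))) (range₂-indicator b)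

α β γ : (Bool → Bool → ℤ) → ℤ
α h = h true false - h false false
β h = h false true - h false false
γ h = h true true - h true false - h false true + h false false

unary-split : (h : Bool → ℤ) (b : Bool) → h b ≡ h false + b · (h true - h false)
unary-split h false = sym (+-identityʳ _)
unary-split h true  = shift (h false) (h true)
  where
  shift : ∀ a b → b ≡ a + (b - a)
  shift = solve-∀

binary-split : (h : Bool → Bool → ℤ) (a b : Bool) →
               h a b ≡ h false false + (a · α h + b · β h + (a ∧ b) · γ h)
binary-split h false false = ff (h false false)
  where
  ff : ∀ w → w ≡ w + (0ℤ + 0ℤ + 0ℤ)
  ff = solve-∀
binary-split h true  false = tf (h false false) (h true false)
  where
  tf : ∀ w v → v ≡ w + ((v - w) + 0ℤ + 0ℤ)
  tf = solve-∀
binary-split h false true  = ft (h false false) (h false true)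
  where
  ft : ∀ w v → v ≡ w + (0ℤ + (v - w) + 0ℤ)
  ft = solve-∀
binary-split h true  true  = tt (h false false) (h true false) (h false true) (h true true)
  where
  tt : ∀ w v v′ t → t ≡ w + ((v - w) + (v′ - w) + (t - v - v′ + w))
  tt = solve-∀

γ-bound : (h : Bool → Bool → ℤ) → ∣ γ h ∣≤ range₄ h + range₄ h
γ-bound h =
  subst (λ c → ∣ c ∣≤ range₄ h + range₄ h) (sym (regroup (h false false) (h true false) (h false true) (h true true)))
        (∣∣≤-+ (∣-∣≤range₄ h true true true false) (∣-∣≤range₄ h false false false true))
  where
  regroup : ∀ w v v′ t → t - v - v′ + w ≡ (t - v) + (w - v′)
  regroup = solve-∀

module Simplification {n : ℕ} (C : Instance n) where

  constraint : Fin n × Fin n → Bool → Bool → ℤ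
  constraint e = binary C (proj₁ e) (proj₂ e)

  linearShare : Fin n → Fin n × Fin n → ℤ
  linearShare p e = δ (proj₁ e) p (α (constraint e)) + δ (proj₂ e) p (β (constraint e))

  coefficient : Fin n → ℤ
  coefficient p = (unary C p true - unary C p false) + ∑ (pairs n) (linearShare p)

  simplify : Instance n
  simplify = record
    { nullary = nullary C + ∑ (allFin n) (λ p → unary C p false) + ∑ (pairs n) (λ e → constraint e false false)
    ; unary   = λ p b → b · coefficient p
    ; binary  = λ p q a b → (a ∧ b) · γ (binary C p q)
    }

  module _ (x : Point n) where

    private
      X = lookup x
      unaryLinear linearTerms quadraticTerms : ℤ
      unaryLinear    = ∑ (allFin n) (λ p → X p · (unary C p true - unary C p false))
      linearTerms    = ∑ (pairs n) (λ e → X (proj₁ e) · α (constraint e) + X (proj₂ e) · β (constraint e))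
      quadraticTerms = ∑ (pairs n) (λ e → (X (proj₁ e) ∧ X (proj₂ e)) · γ (constraint e))

    ∑-unary : ∑ (allFin n) (λ p → unary C p (X p)) ≡ ∑ (allFin n) (λ p → unary C p false) + unaryLinear
    ∑-unary = trans (∑-cong (allFin n) (λ p → unary-split (unary C p) (X p))) (∑-distrib-+ (allFin n) _ _)

    ∑-binary : ∑ (pairs n) (λ e → constraint e (X (proj₁ e)) (X (proj₂ e)))
             ≡ ∑ (pairs n) (λ e → constraint e false false) + (linearTerms + quadraticTerms)
    ∑-binary = trans (∑-cong (pairs n) (λ e → binary-split (constraint e) (X (proj₁ e)) (X (proj₂ e))))
               (trans (∑-distrib-+ (pairs n) _ _)
                      (cong (λ s → ∑ (pairs n) (λ e → constraint e false false) + s) (∑-distrib-+ (pairs n) _ _)))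

    ∑-linearShare : ∀ e → ∑ (allFin n) (λ p → X p · linearShare p e)
                        ≡ X (proj₁ e) · α (constraint e) + X (proj₂ e) · β (constraint e)
    ∑-linearShare (i , j) = begin
        ∑ (allFin n) (λ p → X p · linearShare p (i , j))
      ≡⟨ ∑-cong (allFin n) (λ p →
           trans (·-distrib-+ (X p) _ _) (cong₂ _+_ (·-δ (X p) i p _) (·-δ (X p) j p _))) ⟩
        ∑ (allFin n) (λ p → δ i p (X p · α (binary C i j)) + δ j p (X p · β (binary C i j)))
      ≡⟨ ∑-distrib-+ (allFin n) _ _ ⟩
        ∑ (allFin n) (λ p → δ i p (X p · α (binary C i j))) + ∑ (allFin n) (λ p → δ j p (X p · β (binary C i j)))
      ≡⟨ cong₂ _+_ (∑-δ i (λ p → X p · α (binary C i j))) (∑-δ j (λ p → X p · β (binary C i j))) ⟩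
        X i · α (binary C i j) + X j · β (binary C i j) ∎
      where open ≡-Reasoning

    ∑-coefficient : ∑ (allFin n) (λ p → X p · coefficient p) ≡ unaryLinear + linearTerms
    ∑-coefficient = begin
        ∑ (allFin n) (λ p → X p · coefficient p)
      ≡⟨ trans (∑-cong (allFin n) (λ p → ·-distrib-+ (X p) _ _)) (∑-distrib-+ (allFin n) _ _) ⟩
        unaryLinear + ∑ (allFin n) (λ p → X p · ∑ (pairs n) (linearShare p))
      ≡⟨ cong (λ s → unaryLinear + s) (∑-cong (allFin n) (λ p → ·-∑ (X p) (pairs n) (linearShare p))) ⟩
        unaryLinear + ∑ (allFin n) (λ p → ∑ (pairs n) (λ e → X p · linearShare p e))
      ≡⟨ cong (λ s → unaryLinear + s) (∑-comm (allFin n) (pairs n) (λ p e → X p · linearShare p e)) ⟩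
        unaryLinear + ∑ (pairs n) (λ e → ∑ (allFin n) (λ p → X p · linearShare p e))
      ≡⟨ cong (λ s → unaryLinear + s) (∑-cong (pairs n) ∑-linearShare) ⟩
        unaryLinear + linearTerms ∎
      where open ≡-Reasoning

    eval-simplify : eval simplify x ≡ eval C x
    eval-simplify = begin
        eval simplify x
      ≡⟨ cong (λ s → nullary simplify + s + quadraticTerms) ∑-coefficient ⟩
        nullary simplify + (unaryLinear + linearTerms) + quadraticTerms
      ≡⟨ regroup (nullary C) _ _ unaryLinear linearTerms quadraticTerms ⟩
        nullary C + (∑ (allFin n) (λ p → unary C p false) + unaryLinear)
          + (∑ (pairs n) (λ e → constraint e false false) + (linearTerms + quadraticTerms))
      ≡⟨ sym (cong₂ (λ s t → nullary C + s + t) ∑-unary ∑-binary) ⟩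
        eval C x ∎
      where
      open ≡-Reasoning
      regroup : ∀ c u₀ g₀ ul lt qt → c + u₀ + g₀ + (ul + lt) + qt ≡ c + (u₀ + ul) + (g₀ + (lt + qt))
      regroup = solve-∀

  private
    unaryRanges binaryRanges : ℤ
    unaryRanges  = ∑ (allFin n) (λ p → range₂ (unary C p))
    binaryRanges = ∑ (pairs n) (λ e → range₄ (constraint e))

    coefficientBound : Fin n → ℤ
    coefficientBound p = range₂ (unary C p)
      + ∑ (pairs n) (λ e → δ (proj₁ e) p (range₄ (constraint e)) + δ (proj₂ e) p (range₄ (constraint e)))

  coefficient-bound : ∀ p → ∣ coefficient p ∣≤ coefficientBound p
  coefficient-bound p = ∣∣≤-+ (∣-∣≤range₂ (unary C p) true false) (∣∣≤-∑ (pairs n) λ e →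
    ∣∣≤-+ (∣∣≤-δ (proj₁ e) p (∣-∣≤range₄ (constraint e) true false false false))
          (∣∣≤-δ (proj₂ e) p (∣-∣≤range₄ (constraint e) false true false false)))

  -- Each binary range is charged once to each of the two variables in its scope.
  ∑-coefficientBound : ∑ (allFin n) coefficientBound ≡ unaryRanges + (binaryRanges + binaryRanges)
  ∑-coefficientBound = begin
      ∑ (allFin n) coefficientBound
    ≡⟨ ∑-distrib-+ (allFin n) _ _ ⟩
      unaryRanges + ∑ (allFin n) (λ p → ∑ (pairs n) (share p))
    ≡⟨ cong (λ s → unaryRanges + s) (∑-comm (allFin n) (pairs n) share) ⟩
      unaryRanges + ∑ (pairs n) (λ e → ∑ (allFin n) (λ p → share p e))
    ≡⟨ cong (λ s → unaryRanges + s) (∑-cong (pairs n) λ e → trans (∑-distrib-+ (allFin n) _ _)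
         (cong₂ _+_ (∑-δ (proj₁ e) (λ _ → range₄ (constraint e)))
                    (∑-δ (proj₂ e) (λ _ → range₄ (constraint e))))) ⟩
      unaryRanges + ∑ (pairs n) (λ e → range₄ (constraint e) + range₄ (constraint e))
    ≡⟨ cong (λ s → unaryRanges + s) (∑-distrib-+ (pairs n) _ _) ⟩
      unaryRanges + (binaryRanges + binaryRanges) ∎
    where
    open ≡-Reasoning
    share : Fin n → Fin n × Fin n → ℤ
    share p e = δ (proj₁ e) p (range₄ (constraint e)) + δ (proj₂ e) p (range₄ (constraint e))

  span-simplify : span simplify ≤ + 4 * span C
  span-simplify = begin
      span simplify
    ≤⟨ +-mono-≤ (+-mono-≤ (≤-refl {N - N}) (∑-mono-≤ (allFin n) (range₂-indicator ∘ coefficient-bound)))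
                (∑-mono-≤ (pairs n) (λ e → range₄-indicator (γ-bound (constraint e)))) ⟩
      N - N + ∑ (allFin n) coefficientBound + ∑ (pairs n) (λ e → range₄ (constraint e) + range₄ (constraint e))
    ≡⟨ cong₂ (λ s t → N - N + s + t) ∑-coefficientBound (∑-distrib-+ (pairs n) _ _) ⟩
      N - N + (unaryRanges + (binaryRanges + binaryRanges)) + (binaryRanges + binaryRanges)
    ≤⟨ i≤i+nonneg (+-mono-≤ (+-mono-≤ U≥0 U≥0) U≥0) ⟩
      N - N + (unaryRanges + (binaryRanges + binaryRanges)) + (binaryRanges + binaryRanges)
        + (unaryRanges + unaryRanges + unaryRanges)
    ≡⟨ regroup N (nullary C) unaryRanges binaryRanges ⟩
      + 4 * span C ∎
    where
    open ≤-Reasoning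
    N = nullary simplify
    U≥0 : 0ℤ ≤ unaryRanges
    U≥0 = ∑-nonneg (allFin n) (λ p → range₂-nonneg (unary C p))
    regroup : ∀ N c U G → N - N + (U + (G + G)) + (G + G) + (U + U + U) ≡ + 4 * (c - c + U + G)
    regroup = solve-∀

lookup-flip-self : ∀ {n} (x : Point n) k → lookup (flip x k) k ≡ not (lookup x k)
lookup-flip-self x k = lookup∘update k x _

lookup-flip-other : ∀ {n} (x : Point n) {k p} → p ≢ k → lookup (flip x k) p ≡ lookup x p
lookup-flip-other x p≢k = lookup∘update′ p≢k x _

flip-involutive : ∀ {n} (x : Point n) k → flip (flip x k) k ≡ x
flip-involutive x k = begin
    (x [ k ]≔ not (lookup x k)) [ k ]≔ not (lookup (flip x k) k)
  ≡⟨ []≔-idempotent x k ⟩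
    x [ k ]≔ not (lookup (flip x k) k)
  ≡⟨ cong (λ b → x [ k ]≔ not b) (lookup-flip-self x k) ⟩
    x [ k ]≔ not (not (lookup x k))
  ≡⟨ cong (x [ k ]≔_) (not-involutive _) ⟩
    x [ k ]≔ lookup x k
  ≡⟨ []≔-lookup x k ⟩
    x ∎
  where open ≡-Reasoning

flip-comm : ∀ {n} (x : Point n) {i j} → i ≢ j → flip (flip x i) j ≡ flip (flip x j) i
flip-comm x {i} {j} i≢j = begin
    flip x i [ j ]≔ not (lookup (flip x i) j)
  ≡⟨ cong (λ b → flip x i [ j ]≔ not b) (lookup-flip-other x (i≢j ∘ sym)) ⟩
    (x [ i ]≔ not (lookup x i)) [ j ]≔ not (lookup x j)
  ≡⟨ []≔-commutes x i j i≢j ⟩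
    (x [ j ]≔ not (lookup x j)) [ i ]≔ not (lookup x i)
  ≡⟨ cong (λ b → flip x j [ i ]≔ not b) (sym (lookup-flip-other x i≢j)) ⟩
    flip x j [ i ]≔ not (lookup (flip x j) i) ∎
  where open ≡-Reasoning

Independent : ∀ {n} → (Point n → ℤ) → Fin n → Set
Independent φ k = ∀ x → φ (flip x k) ≡ φ x

NoInteraction : ∀ {n} → (Point n → ℤ) → Fin n → Fin n → Set
NoInteraction φ i j = ∀ x → φ (flip x i) + φ (flip x j) ≡ φ x + φ (flip (flip x j) i)

independent⇒noInteraction : ∀ {n} {φ : Point n → ℤ} {i j} → i ≢ j →
                            Independent φ i ⊎ Independent φ j → NoInteraction φ i j
independent⇒noInteraction {φ = φ} {i} {j} i≢j (inj₁ indep-i) x =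
  cong₂ _+_ (indep-i x) (sym (indep-i (flip x j)))
independent⇒noInteraction {φ = φ} {i} {j} i≢j (inj₂ indep-j) x = begin
    φ (flip x i) + φ (flip x j)          ≡⟨ +-comm (φ (flip x i)) _ ⟩
    φ (flip x j) + φ (flip x i)          ≡⟨ cong₂ _+_ (indep-j x) (sym (indep-j (flip x i))) ⟩
    φ x + φ (flip (flip x i) j)          ≡⟨ cong (λ y → φ x + φ y) (flip-comm x i≢j) ⟩
    φ x + φ (flip (flip x j) i)          ∎
  where open ≡-Reasoning

noInteraction-sym : ∀ {n} {φ : Point n → ℤ} {i j} → i ≢ j → NoInteraction φ i j → NoInteraction φ j i
noInteraction-sym {φ = φ} {i} {j} i≢j h x = begin
    φ (flip x j) + φ (flip x i)          ≡⟨ +-comm (φ (flip x j)) _ ⟩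
    φ (flip x i) + φ (flip x j)          ≡⟨ h x ⟩
    φ x + φ (flip (flip x j) i)          ≡⟨ cong (λ y → φ x + φ y) (sym (flip-comm x i≢j)) ⟩
    φ x + φ (flip (flip x i) j)          ∎
  where open ≡-Reasoning

unaryTerm : ∀ {n} → Instance n → Point n → Fin n → ℤ
unaryTerm C x p = unary C p (lookup x p)

binaryTerm : ∀ {n} → Instance n → Point n → Fin n × Fin n → ℤ
binaryTerm C x e = binary C (proj₁ e) (proj₂ e) (lookup x (proj₁ e)) (lookup x (proj₂ e))

eval-cong : ∀ {n} (C D : Instance n) {x y : Point n} → nullary C ≡ nullary D →
            (∀ p → unaryTerm C x p ≡ unaryTerm D y p) → (∀ e → binaryTerm C x e ≡ binaryTerm D y e) →
            eval C x ≡ eval D y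
eval-cong {n} C D hn hu hb = cong₂ _+_ (cong₂ _+_ hn (∑-cong (allFin n) hu)) (∑-cong (pairs n) hb)

eval-+-eval : ∀ {n} (C D : Instance n) (x y : Point n) →
  eval C x + eval D y ≡ nullary C + nullary D + ∑ (allFin n) (λ p → unaryTerm C x p + unaryTerm D y p)
                        + ∑ (pairs n) (λ e → binaryTerm C x e + binaryTerm D y e)
eval-+-eval {n} C D x y = begin
    eval C x + eval D y
  ≡⟨ regroup (nullary C) (∑ (allFin n) (unaryTerm C x)) (∑ (pairs n) (binaryTerm C x))
             (nullary D) (∑ (allFin n) (unaryTerm D y)) (∑ (pairs n) (binaryTerm D y)) ⟩
    nullary C + nullary D + (∑ (allFin n) (unaryTerm C x) + ∑ (allFin n) (unaryTerm D y))
      + (∑ (pairs n) (binaryTerm C x) + ∑ (pairs n) (binaryTerm D y))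
  ≡⟨ sym (cong₂ (λ s t → nullary C + nullary D + s + t)
                (∑-distrib-+ (allFin n) (unaryTerm C x) (unaryTerm D y))
                (∑-distrib-+ (pairs n) (binaryTerm C x) (binaryTerm D y))) ⟩
    nullary C + nullary D + ∑ (allFin n) (λ p → unaryTerm C x p + unaryTerm D y p)
      + ∑ (pairs n) (λ e → binaryTerm C x e + binaryTerm D y e) ∎
  where
  open ≡-Reasoning
  regroup : ∀ c u b c′ u′ b′ → c + u + b + (c′ + u′ + b′) ≡ c + c′ + (u + u′) + (b + b′)
  regroup = solve-∀

eval-+-cong : ∀ {n} (C₁ C₂ C₃ C₄ : Instance n) {x₁ x₂ x₃ x₄ : Point n} →
  nullary C₁ + nullary C₂ ≡ nullary C₃ + nullary C₄ →
  (∀ p → unaryTerm C₁ x₁ p + unaryTerm C₂ x₂ p ≡ unaryTerm C₃ x₃ p + unaryTerm C₄ x₄ p) →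
  (∀ e → binaryTerm C₁ x₁ e + binaryTerm C₂ x₂ e ≡ binaryTerm C₃ x₃ e + binaryTerm C₄ x₄ e) →
  eval C₁ x₁ + eval C₂ x₂ ≡ eval C₃ x₃ + eval C₄ x₄
eval-+-cong {n} C₁ C₂ C₃ C₄ {x₁} {x₂} {x₃} {x₄} hn hu hb =
  trans (eval-+-eval C₁ C₂ x₁ x₂)
        (trans (cong₂ _+_ (cong₂ _+_ hn (∑-cong (allFin n) hu)) (∑-cong (pairs n) hb))
               (sym (eval-+-eval C₃ C₄ x₃ x₄)))

eval-noInteraction : ∀ {n} {C : Instance n} {i j} → i ≢ j →
  (∀ p → Independent (λ x → unaryTerm C x p) i ⊎ Independent (λ x → unaryTerm C x p) j) →
  (∀ e → Independent (λ x → binaryTerm C x e) i ⊎ Independent (λ x → binaryTerm C x e) j) →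
  NoInteraction (eval C) i j
eval-noInteraction {C = C} {i} {j} i≢j hu hb x =
  eval-+-cong C C C C {flip x i} {flip x j} {x} {flip (flip x j) i} refl
              (λ p → independent⇒noInteraction i≢j (hu p) x) (λ e → independent⇒noInteraction i≢j (hb e) x)

unaryTerm-independent : ∀ {n} (C : Instance n) {p k} → p ≢ k → Independent (λ x → unaryTerm C x p) k
unaryTerm-independent C {p} p≢k x = cong (unary C p) (lookup-flip-other x p≢k)

binary-independent : ∀ {n} (t : Bool → Bool → ℤ) {p q k : Fin n} → p ≢ k → q ≢ k →
                     Independent (λ x → t (lookup x p) (lookup x q)) k
binary-independent t p≢k q≢k x = cong₂ t (lookup-flip-other x p≢k) (lookup-flip-other x q≢k)

Improves : ∀ {n} → (Point n → ℤ) → Point n → Fin n → Set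
Improves f x k = f x <ℤ f (flip x k)

<-exchange : ∀ {a b c d} → a + b ≡ c + d → a <ℤ d → c <ℤ b
<-exchange {a} {b} {c} {d} eq a<d =
  subst₂ _<ℤ_ (cancel c d) (cancel b d) (+-monoˡ-< (- d) (subst₂ _<ℤ_ eq (+-comm d b) (+-monoˡ-< b a<d)))
  where
  cancel : ∀ u v → u + v + - v ≡ u
  cancel = solve-∀

improves-⇔ : ∀ {n} {f g : Point n → ℤ} {x k} →
             f x + g (flip x k) ≡ g x + f (flip x k) → Improves f x k ⇔ Improves g x k
improves-⇔ eq = mk⇔ (<-exchange eq) (<-exchange (sym eq))

-- A flip of i at x with x_j = 1 is compared with the same flip at x^j, where f and g agree:
-- stability of f transports the f-comparison, and the absence of interaction in g the g-comparison.
improves-transfer : ∀ {n} {f g : Point n → ℤ} {i j} → i ≢ j →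
  (∀ z → lookup z j ≡ false → f z ≡ g z) → NoInteraction g i j →
  (∀ y → Improves f y i → Improves f (flip y j) i) →
  ∀ x → Improves f x i ⇔ Improves g x i
improves-transfer {f = f} {g} {i} {j} i≢j agree g-noInteraction f-stable x with lookup x j in xj
... | false = mk⇔ (subst₂ _<ℤ_ agree-x agree-xi) (subst₂ _<ℤ_ (sym agree-x) (sym agree-xi))
  where
  agree-x : f x ≡ g x
  agree-x = agree x xj
  agree-xi : f (flip x i) ≡ g (flip x i)
  agree-xi = agree (flip x i) (trans (lookup-flip-other x (i≢j ∘ sym)) xj)
... | true = mk⇔ forward backward
  where
  w = flip x j
  wj : lookup w j ≡ false
  wj = trans (lookup-flip-self x j) (cong not xj)
  agree-w : f w ≡ g w
  agree-w = agree w wj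
  agree-wi : f (flip w i) ≡ g (flip w i)
  agree-wi = agree (flip w i) (trans (lookup-flip-other w (i≢j ∘ sym)) wj)
  square : g w + g (flip x i) ≡ g x + g (flip w i)
  square = trans (+-comm (g w) _) (g-noInteraction x)
  forward : Improves f x i → Improves g x i
  forward lt = <-exchange square (subst₂ _<ℤ_ agree-w agree-wi (f-stable x lt))
  backward : Improves g x i → Improves f x i
  backward lt = subst (λ y → Improves f y i) (flip-involutive x j)
    (f-stable w (subst₂ _<ℤ_ (sym agree-w) (sym agree-wi) (<-exchange (sym square) lt)))

module _ {n : ℕ} where

  signEquivalent-improves : {C D : Instance n} →
    (∀ x k → Improves (eval C) x k ⇔ Improves (eval D) x k) → SignEquivalent C D
  signEquivalent-improves h x y =
    (λ { ((k , refl) , lt) → (k , refl) , to (h x k) lt }) ,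
    (λ { ((k , refl) , lt) → (k , refl) , from (h x k) lt })

  signEquivalent-eval : {C D : Instance n} → (∀ x → eval C x ≡ eval D x) → SignEquivalent C D
  signEquivalent-eval {C} {D} h = signEquivalent-improves {C = C} {D = D} λ x k →
    mk⇔ (subst₂ _<ℤ_ (h x) (h (flip x k))) (subst₂ _<ℤ_ (sym (h x)) (sym (h (flip x k))))

  signEquivalent-sym : {C D : Instance n} → SignEquivalent C D → SignEquivalent D C
  signEquivalent-sym C~D x y = proj₂ (C~D x y) , proj₁ (C~D x y)

  signEquivalent-trans : {C D E : Instance n} → SignEquivalent C D → SignEquivalent D E → SignEquivalent C E
  signEquivalent-trans C~D D~E x y =
    proj₁ (D~E x y) ∘ proj₁ (C~D x y) , proj₂ (C~D x y) ∘ proj₂ (D~E x y)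

  signDepends-transfer : {C D : Instance n} → SignEquivalent C D → ∀ {i j} → SignDepends C i j → SignDepends D i j
  signDepends-transfer C~D {i} {j} (x , edge , ¬edge) =
    x , proj₁ (C~D x (flip x i)) edge , ¬edge ∘ proj₂ (C~D (flip x j) (flip (flip x j) i))

  signInteract-transfer : {C D : Instance n} → SignEquivalent C D → ∀ {i j} → SignInteract C i j → SignInteract D i j
  signInteract-transfer {C} {D} C~D (inj₁ dep) = inj₁ (signDepends-transfer {C = C} {D = D} C~D dep)
  signInteract-transfer {C} {D} C~D (inj₂ dep) = inj₂ (signDepends-transfer {C = C} {D = D} C~D dep)

  ¬signDepends⇒stable : (C : Instance n) {i j : Fin n} → ¬ SignDepends C i j →
                        ∀ y → Improves (eval C) y i → Improves (eval C) (flip y j) i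
  ¬signDepends⇒stable C {i} {j} ¬dep y lt with eval C (flip y j) <? eval C (flip (flip y j) i)
  ... | yes lt′ = lt′
  ... | no ¬lt′ = ⊥-elim (¬dep (y , ((i , refl) , lt) , ¬lt′ ∘ proj₂))

SameScope : ∀ {n} → Fin n → Fin n → Fin n → Fin n → Set
SameScope i j p q = (p ≡ i × q ≡ j) ⊎ (p ≡ j × q ≡ i)

sameScope? : ∀ {n} (i j p q : Fin n) → Dec (SameScope i j p q)
sameScope? i j p q = (p ≟ i ×-dec q ≟ j) ⊎-dec (p ≟ j ×-dec q ≟ i)

sameScope-avoids : ∀ {n} {i j p q k : Fin n} → SameScope i j p q → k ≢ i → k ≢ j → p ≢ k × q ≢ k
sameScope-avoids (inj₁ (refl , refl)) k≢i k≢j = k≢i ∘ sym , k≢j ∘ sym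
sameScope-avoids (inj₂ (refl , refl)) k≢i k≢j = k≢j ∘ sym , k≢i ∘ sym

¬sameScope-avoids : ∀ {n} {i j p q : Fin n} → i ≢ j → ¬ SameScope i j p q →
                    (p ≢ i × q ≢ i) ⊎ (p ≢ j × q ≢ j)
¬sameScope-avoids {i = i} {j} {p} {q} i≢j ¬same with p ≟ i | q ≟ i
... | no p≢i   | no q≢i   = inj₁ (p≢i , q≢i)
... | yes refl | _        = inj₂ (i≢j , λ q≡j → ¬same (inj₁ (refl , q≡j)))
... | no _     | yes refl = inj₂ ((λ p≡j → ¬same (inj₂ (p≡j , refl))) , i≢j)

SimpleAt : ∀ {n} → Instance n → Fin n → Fin n → Set
SimpleAt A i j = ∀ {p q} → SameScope i j p q → ∀ a b → a ≡ false ⊎ b ≡ false → binary A p q a b ≡ 0ℤ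

dropIf : {P : Set} → Dec P → ℤ → ℤ
dropIf (yes _) v = 0ℤ
dropIf (no _)  v = v

removeConstraint : ∀ {n} → Instance n → Fin n → Fin n → Instance n
removeConstraint A i j = record A { binary = λ p q a b → dropIf (sameScope? i j p q) (binary A p q a b) }

module _ {n : ℕ} (A : Instance n) {i j p q : Fin n} where

  removeConstraint-on : SameScope i j p q → ∀ a b → binary (removeConstraint A i j) p q a b ≡ 0ℤ
  removeConstraint-on same a b with sameScope? i j p q
  ... | yes _    = refl
  ... | no ¬same = ⊥-elim (¬same same)

  removeConstraint-zero : ∀ {a b} → binary A p q a b ≡ 0ℤ → binary (removeConstraint A i j) p q a b ≡ 0ℤ
  removeConstraint-zero vanishes with sameScope? i j p q
  ... | yes _ = refl
  ... | no _  = vanishes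

module RemoveConstraint {n : ℕ} (A : Instance n) {i j : Fin n} (i≢j : i ≢ j) where

  private
    B = removeConstraint A i j

  eval-removeConstraint-agree : SimpleAt A i j →
    ∀ z → lookup z i ≡ false ⊎ lookup z j ≡ false → eval A z ≡ eval B z
  eval-removeConstraint-agree simple z zᵢ∨zⱼ = eval-cong A B {z} {z} refl (λ _ → refl) term
    where
    scope-false : ∀ {p q} → SameScope i j p q → lookup z p ≡ false ⊎ lookup z q ≡ false
    scope-false (inj₁ (refl , refl)) = zᵢ∨zⱼ
    scope-false (inj₂ (refl , refl)) = ⊎-swap zᵢ∨zⱼ
    term : ∀ e → binaryTerm A z e ≡ binaryTerm B z e
    term (p , q) with sameScope? i j p q
    ... | yes same = simple same _ _ (scope-false same)
    ... | no _     = refl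

  noInteraction-removeConstraint : NoInteraction (eval B) i j
  noInteraction-removeConstraint = eval-noInteraction {C = B} i≢j unary-independent binary-independent′
    where
    unary-independent : ∀ p → Independent (λ x → unaryTerm B x p) i ⊎ Independent (λ x → unaryTerm B x p) j
    unary-independent p with p ≟ i
    ... | yes refl = inj₂ (unaryTerm-independent B i≢j)
    ... | no p≢i   = inj₁ (unaryTerm-independent B p≢i)
    binary-independent′ : ∀ e → Independent (λ x → binaryTerm B x e) i ⊎ Independent (λ x → binaryTerm B x e) j
    binary-independent′ (p , q) with sameScope? i j p q
    ... | yes _    = inj₁ (λ _ → refl)
    ... | no ¬same with ¬sameScope-avoids i≢j ¬same
    ...   | inj₁ (p≢i , q≢i) = inj₁ (binary-independent (binary A p q) p≢i q≢i)
    ...   | inj₂ (p≢j , q≢j) = inj₂ (binary-independent (binary A p q) p≢j q≢j)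

  eval-removeConstraint-other : ∀ {k} → k ≢ i → k ≢ j →
    ∀ x → eval A x + eval B (flip x k) ≡ eval B x + eval A (flip x k)
  eval-removeConstraint-other {k} k≢i k≢j x = eval-+-cong A B B A {x} {y} {x} {y} refl (λ _ → refl) term
    where
    y = flip x k
    term : ∀ e → binaryTerm A x e + binaryTerm B y e ≡ binaryTerm B x e + binaryTerm A y e
    term (p , q) with sameScope? i j p q
    ... | no _     = refl
    ... | yes same = trans (+-identityʳ _)
                     (trans (sym (binary-independent (binary A p q) p≢k q≢k x)) (sym (+-identityˡ _)))
      where
      p≢k = proj₁ (sameScope-avoids same k≢i k≢j)
      q≢k = proj₂ (sameScope-avoids same k≢i k≢j)

removeConstraint-signEquivalent : ∀ {n} (A : Instance n) {i j} → i ≢ j → SimpleAt A i j →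
                                  ¬ SignInteract A i j → SignEquivalent A (removeConstraint A i j)
removeConstraint-signEquivalent A {i} {j} i≢j simple ¬interact =
  signEquivalent-improves {C = A} {D = removeConstraint A i j} improves
  where
  open RemoveConstraint A i≢j
  improves : ∀ x k → Improves (eval A) x k ⇔ Improves (eval (removeConstraint A i j)) x k
  improves x k with k ≟ i | k ≟ j
  ... | yes refl | _ =
    improves-transfer i≢j (λ z zⱼ → eval-removeConstraint-agree simple z (inj₂ zⱼ)) noInteraction-removeConstraint
                      (¬signDepends⇒stable A (¬interact ∘ inj₁)) x
  ... | no _ | yes refl =
    improves-transfer (i≢j ∘ sym) (λ z zᵢ → eval-removeConstraint-agree simple z (inj₁ zᵢ))
                      (noInteraction-sym {φ = eval (removeConstraint A i j)} i≢j noInteraction-removeConstraint)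
                      (¬signDepends⇒stable A (¬interact ∘ inj₂)) x
  ... | no k≢i | no k≢j =
    improves-⇔ {f = eval A} {g = eval (removeConstraint A i j)} {x} {k} (eval-removeConstraint-other k≢i k≢j x)

∃-point? : ∀ {n} {P : Point n → Set} → (∀ x → Dec (P x)) → Dec (∃[ x ] P x)
∃-point? {zero} P? with P? []
... | yes px = yes ([] , px)
... | no ¬px = no λ { ([] , px) → ¬px px }
∃-point? {suc n} P? with ∃-point? (λ x → P? (false ∷ x)) | ∃-point? (λ x → P? (true ∷ x))
... | yes (x , px) | _            = yes (false ∷ x , px)
... | no _         | yes (x , px) = yes (true ∷ x , px)
... | no ¬p₀       | no ¬p₁       =
  no λ { (false ∷ x , px) → ¬p₀ (x , px) ; (true ∷ x , px) → ¬p₁ (x , px) }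

module _ {n : ℕ} (C : Instance n) where

  edge? : ∀ x y → Dec (Edge C x y)
  edge? x y = any? (λ k → ≡-dec _≟ᵇ_ y (flip x k)) ×-dec (eval C x <? eval C y)

  signDepends? : ∀ i j → Dec (SignDepends C i j)
  signDepends? i j = ∃-point? λ x → edge? x (flip x i) ×-dec ¬? (edge? (flip x j) (flip (flip x j) i))

  signInteract? : ∀ i j → Dec (SignInteract C i j)
  signInteract? i j = signDepends? i j ⊎-dec signDepends? j i

module Trimming {n : ℕ} (C′ : Instance n) where

  open Simplification C′ using (simplify; eval-simplify)

  ZeroOrSimplified : Instance n → Fin n → Fin n → Set
  ZeroOrSimplified T p q =
    (∀ a b → binary T p q a b ≡ 0ℤ) ⊎ (∀ a b → binary T p q a b ≡ binary simplify p q a b)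

  record Invariant (T : Instance n) : Set where
    field
      nullary≡ : nullary T ≡ nullary simplify
      unary≡ : ∀ p b → unary T p b ≡ unary simplify p b
      zeroOrSimplified : ∀ p q → ZeroOrSimplified T p q
      equivalent : SignEquivalent T simplify
  open Invariant

  binary-vanishes : ∀ {T} → Invariant T → ∀ p q a b → a ≡ false ⊎ b ≡ false → binary T p q a b ≡ 0ℤ
  binary-vanishes inv p q a b a∨b with zeroOrSimplified inv p q
  ... | inj₁ allZero    = allZero a b
  ... | inj₂ simplified = trans (simplified a b) (·-vanishes _ a∨b)

  Removable : Fin n → Fin n → Set
  Removable i j = i ≢ j × ¬ SignInteract simplify i j

  removable? : ∀ i j → Dec (Removable i j)
  removable? i j = ¬? (i ≟ j) ×-dec ¬? (signInteract? simplify i j)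

  trimStep : (i j : Fin n) → Dec (Removable i j) → Instance n → Instance n
  trimStep i j (yes _) T = removeConstraint T i j
  trimStep i j (no _)  T = T

  trimAll : List (Fin n × Fin n) → Instance n
  trimAll []            = simplify
  trimAll ((i , j) ∷ l) = trimStep i j (removable? i j) (trimAll l)

  invariant-trimStep : ∀ i j d {T} → Invariant T → Invariant (trimStep i j d T)
  invariant-trimStep i j (no _) inv = inv
  invariant-trimStep i j (yes (i≢j , ¬interact)) {T} inv = record
    { nullary≡ = nullary≡ inv
    ; unary≡ = unary≡ inv
    ; zeroOrSimplified = zeroOrSimplified′
    ; equivalent = signEquivalent-trans {C = removeConstraint T i j} {D = T} {E = simplify}
        (signEquivalent-sym {C = T} {D = removeConstraint T i j} T~removed) (equivalent inv)
    }
    where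
    T~removed : SignEquivalent T (removeConstraint T i j)
    T~removed = removeConstraint-signEquivalent T i≢j (λ {p} {q} _ → binary-vanishes inv p q)
                  (¬interact ∘ signInteract-transfer {C = T} {D = simplify} (equivalent inv))
    zeroOrSimplified′ : ∀ p q → ZeroOrSimplified (removeConstraint T i j) p q
    zeroOrSimplified′ p q with sameScope? i j p q
    ... | yes _ = inj₁ (λ _ _ → refl)
    ... | no _  = zeroOrSimplified inv p q

  invariant-trimAll : ∀ l → Invariant (trimAll l)
  invariant-trimAll [] = record
    { nullary≡ = refl ; unary≡ = λ _ _ → refl ; zeroOrSimplified = λ _ _ → inj₂ (λ _ _ → refl)
    ; equivalent = λ _ _ → id , id }
  invariant-trimAll ((i , j) ∷ l) = invariant-trimStep i j (removable? i j) (invariant-trimAll l)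

  trimStep-zero : ∀ i j d T {p q a b} → binary T p q a b ≡ 0ℤ → binary (trimStep i j d T) p q a b ≡ 0ℤ
  trimStep-zero i j (yes _) T vanishes = removeConstraint-zero T vanishes
  trimStep-zero i j (no _)  T vanishes = vanishes

  trimAll-removes : ∀ l {p q} → (p , q) ∈ l → Removable p q → ∀ a b → binary (trimAll l) p q a b ≡ 0ℤ
  trimAll-removes ((i , j) ∷ l) (there p,q∈l) removable a b =
    trimStep-zero i j (removable? i j) (trimAll l) (trimAll-removes l p,q∈l removable a b)
  trimAll-removes ((p , q) ∷ l) (here refl) removable a b with removable? p q
  ... | yes _           = removeConstraint-on (trimAll l) (inj₁ (refl , refl)) a b
  ... | no ¬removable   = ⊥-elim (¬removable removable)

  trimmed : Instance n
  trimmed = trimAll (cartesianProduct (allFin n) (allFin n))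

  invariant-trimmed : Invariant trimmed
  invariant-trimmed = invariant-trimAll (cartesianProduct (allFin n) (allFin n))

  trimmed-simple : Simple trimmed
  trimmed-simple = (λ p → unary≡ invariant-trimmed p false)
                 , (λ p q _ → vanishes p q false false (inj₁ refl)
                            , vanishes p q false true (inj₁ refl)
                            , vanishes p q true false (inj₂ refl))
    where vanishes = binary-vanishes invariant-trimmed

  trimmed-trim : Trim trimmed
  trimmed-trim = trimmed-simple , interact
    where
    interact : ∀ i j → InE trimmed i j → SignInteract trimmed i j
    interact i j (i<j , a , b , nonzero) with signInteract? simplify i j
    ... | yes interacts = signInteract-transfer {C = simplify} {D = trimmed}
                            (signEquivalent-sym {C = trimmed} {D = simplify} (equivalent invariant-trimmed)) interacts
    ... | no ¬interacts = ⊥-elim (nonzero (trimAll-removes _ (∈-cartesianProduct⁺ (∈-allFin i) (∈-allFin j))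
                                                          (<⇒≢ i<j , ¬interacts) a b))

  trimmed-equivalent : SignEquivalent trimmed C′
  trimmed-equivalent = signEquivalent-trans {C = trimmed} {D = simplify} {E = C′}
    (equivalent invariant-trimmed) (signEquivalent-eval {C = simplify} {D = C′} eval-simplify)

  span-trimmed : span trimmed ≤ span simplify
  span-trimmed =
    +-mono-≤ (+-mono-≤ (≤-reflexive (cong (λ c → c - c) (nullary≡ invariant-trimmed)))
                       (≤-reflexive (∑-cong (allFin n) (λ p → range₂-cong (unary≡ invariant-trimmed p)))))
             (∑-mono-≤ (pairs n) binary-range)
    where
    binary-range : ∀ e → range₄ (binary trimmed (proj₁ e) (proj₂ e))
                       ≤ range₄ (binary simplify (proj₁ e) (proj₂ e))
    binary-range (p , q) with zeroOrSimplified invariant-trimmed p q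
    ... | inj₁ allZero    = subst (_≤ _) (sym (range₄-cong allZero)) (range₄-nonneg (binary simplify p q))
    ... | inj₂ simplified = ≤-reflexive (range₄-cong simplified)

theorem6 : (n : ℕ) (C′ : Instance n) →
    ∃[ C ] Simple C × Trim C × SignEquivalent C C′ × (span C ≤ (+ 4) * span C′)
theorem6 n C′ = trimmed , trimmed-simple , trimmed-trim , trimmed-equivalent
              , ≤-trans span-trimmed (span-simplify C′)
  where
  open Trimming C′
  open Simplification using (span-simplify)
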